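{- In the contextual modal calculus $\lambda^{[-]}$, for every level $l$, all lists $\Gamma,\Gamma'$ of level-$l$ types and all level-$l$ types $A,B,B'$, the following types of level $l+1$ are inhabited by closed terms (with empty context stack): $[\Gamma]A\to[\Gamma,B]A$; $[\Gamma,B,B]A\to[\Gamma,B]A$; $[\Gamma,B,B',\Gamma']A\to[\Gamma,B',B,\Gamma']A$; and $[\Gamma]B\to[\Gamma,B]A\to[\Gamma]A$.
   Context: $\lambda^{[-]}$: levels are natural numbers; types of level $l$ are base types $\iota^l$, $A^l\to B^l$, and (for $l\ge1$) contextual modal types $[A_1,\dots,A_n]B$ with $A_i,B$ of level $l-1$. A context of level $l$ is a list of variable declarations of level-$l$ types; $\mathrm{rg}(\Gamma)$ is the list of its types and $\mathrm{dom}(\Gamma)$ its variables; a context stack of level $l$ is a sequence $\Gamma^{l+n-1};\dots;\Gamma^l$ ($n\ge0$) with levels decreasing by one from left to right. Rules: (Var) if $x:A\in\Gamma^l$ then $\Delta^{l+1};\Gamma^l\vdash^l x:A$; (Abs) from $\Delta^{l+1};\Gamma^l,x:A\vdash^l M:B$ infer $\Delta^{l+1};\Gamma^l\vdash^l\lambda x.M:A\to B$; (App) from $\Delta^l\vdash^l M:A\to B$ and $\Delta^l\vdash^l N:A$ infer $\Delta^l\vdash^l MN:B$; (Quo) from $\Delta;\Gamma\vdash^l M:B$ infer $\Delta\vdash^{l+1}\grave{}^{\langle\mathrm{dom}(\Gamma)\rangle}M:[\mathrm{rg}(\Gamma)]B$; (Unq) from $\Delta\vdash^{l+1}M:[A_1,\dots,A_n]B$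 and $\Delta;\Gamma\vdash^l N_i:A_i$ for $i=1,\dots,n$ infer $\Delta;\Gamma\vdash^l{,}_{\langle N_1,\dots,N_n\rangle}M:B$. -}

module Defs where

open import Data.Nat using (ℕ; suc)
open import Data.List using (List; []; _∷_; map)
open import Data.Product using (_×_; _,_; proj₁; proj₂; ∃)
open import Data.List.Membership.Propositional using (_∈_)

-- Types of level l.  Base types ι^l are drawn from a family of
-- base-type names (ℕ); contextual modal types live at levels ≥ 1.
data Ty : ℕ → Set where
  ι    : ∀ {l} → ℕ → Ty l
  _⇒_  : ∀ {l} → Ty l → Ty l → Ty l
  [_]_ : ∀ {l} → List (Ty l) → Ty l → Ty (suc l)

infixr 5 _⇒_

Var : Set
Var = ℕ

data Tm : Set where
  var : Var → Tm
  lam : Var → Tm → Tm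
  app : Tm → Tm → Tm
  quo : List Var → Tm → Tm      -- `^{⟨x₁,…,xₙ⟩} M
  unq : List Tm → Tm → Tm       -- ,_{⟨N₁,…,Nₙ⟩} M

-- Contexts of level l: lists of variable declarations x : A (A of level l),
-- in order (new declarations are appended on the right: Γ , x : A).
Ctx : ℕ → Set
Ctx l = List (Var × Ty l)

rg : ∀ {l} → Ctx l → List (Ty l)
rg = map proj₂

dom : ∀ {l} → Ctx l → List Var
dom = map proj₁

_,,_ : ∀ {A : Set} → List A → A → List A
[]       ,, a = a ∷ []
(x ∷ xs) ,, a = x ∷ (xs ,, a)

infixl 6 _,,_

-- Context stacks of level l: Γ^{l+n-1}; … ; Γ^l  (n ≥ 0).
data Stack : ℕ → Set where
  ε   : ∀ {l} → Stack l
  _▸_ : ∀ {l} → Stack (suc l) → Ctx l → Stack l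

infixl 4 _▸_

mutual
  data _⊢_∶_ : ∀ {l} → Stack l → Tm → Ty l → Set where
    tvar : ∀ {l} {Δ : Stack (suc l)} {Γ : Ctx l} {x A}
         → (x , A) ∈ Γ → (Δ ▸ Γ) ⊢ var x ∶ A
    tabs : ∀ {l} {Δ : Stack (suc l)} {Γ : Ctx l} {x A B M}
         → (Δ ▸ (Γ ,, (x , A))) ⊢ M ∶ B → (Δ ▸ Γ) ⊢ lam x M ∶ (A ⇒ B)
    tapp : ∀ {l} {Δ : Stack l} {M N A B}
         → Δ ⊢ M ∶ (A ⇒ B) → Δ ⊢ N ∶ A → Δ ⊢ app M N ∶ B
    tquo : ∀ {l} {Δ : Stack (suc l)} {Γ : Ctx l} {M B}
         → (Δ ▸ Γ) ⊢ M ∶ B → Δ ⊢ quo (dom Γ) M ∶ ([ rg Γ ] B)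
    tunq : ∀ {l} {Δ : Stack (suc l)} {Γ : Ctx l} {M Ns As B}
         → Δ ⊢ M ∶ ([ As ] B) → (Δ ▸ Γ) ⊢* Ns ∶ As
         → (Δ ▸ Γ) ⊢ unq Ns M ∶ B

  data _⊢*_∶_ : ∀ {l} → Stack l → List Tm → List (Ty l) → Set where
    []  : ∀ {l} {Δ : Stack l} → Δ ⊢* [] ∶ []
    _∷_ : ∀ {l} {Δ : Stack l} {N Ns A As}
        → Δ ⊢ N ∶ A → Δ ⊢* Ns ∶ As → Δ ⊢* (N ∷ Ns) ∶ (A ∷ As)

-- Inhabited by a closed term: typable in the stack consisting of one
-- empty context (Δ empty, Γ = ·), as required for λ-abstraction.
Closed : ∀ {l} → Ty l → Set
Closed T = ∃ λ M → (ε ▸ []) ⊢ M ∶ T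

-- A box [Γ]A is a term open in a context of type Γ.  Any renaming Γ ⊆ Γ'
-- of the hypotheses turns a box of type [Γ]A into one of type [Γ']A: unquote
-- the given box, instantiating its i-th hypothesis with the variable of Γ'
-- it is renamed to, and quote again over Γ'.  Weakening, contraction and
-- exchange are three instances of such a renaming.  Cut unquotes the box of
-- type [Γ,B]A with the variables of Γ followed by the unquoted box of type [Γ]B.
module Submission where

open import Defs
open import Data.Nat using (ℕ; suc)
open import Data.List using (List; []; _∷_; _++_)
open import Data.Product using (_×_; _,_)
open import Data.Sum using (_⊎_; inj₁; inj₂)
open import Data.List.Membership.Propositional using (_∈_)
open import Data.List.Relation.Unary.Any using (here; there)
open import Data.List.Relation.Binary.Subset.Propositional using (_⊆_)
open import Data.List.Relation.Binary.Permutation.Propositional using (↭-swap; ↭-refl)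
open import Data.List.Relation.Binary.Permutation.Propositional.Properties using (∈-resp-↭; ++⁺ˡ)
open import Relation.Binary.PropositionalEquality using (_≡_; refl; cong; subst)

module _ {X : Set} where

  ∈-,,⁺ˡ : ∀ {xs : List X} {a} → xs ⊆ xs ,, a
  ∈-,,⁺ˡ {_ ∷ _} (here p)  = here p
  ∈-,,⁺ˡ {_ ∷ _} (there p) = there (∈-,,⁺ˡ p)

  ∈-,,⁺ʳ : ∀ (xs : List X) {a} → a ∈ xs ,, a
  ∈-,,⁺ʳ []       = here refl
  ∈-,,⁺ʳ (_ ∷ xs) = there (∈-,,⁺ʳ xs)

  ∈-,,⁻ : ∀ (xs : List X) {a x} → x ∈ xs ,, a → x ∈ xs ⊎ x ≡ a
  ∈-,,⁻ []       (here p)  = inj₂ p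
  ∈-,,⁻ (_ ∷ _)  (here p)  = inj₁ (here p)
  ∈-,,⁻ (_ ∷ xs) (there p) with ∈-,,⁻ xs p
  ... | inj₁ q = inj₁ (there q)
  ... | inj₂ q = inj₂ q

  ,,-contract-⊆ : ∀ (xs : List X) {a} → xs ,, a ,, a ⊆ xs ,, a
  ,,-contract-⊆ xs {a} p with ∈-,,⁻ (xs ,, a) p
  ... | inj₁ q    = q
  ... | inj₂ refl = ∈-,,⁺ʳ xs

  ++-swap-⊆ : ∀ (xs : List X) {a b} ys → xs ++ a ∷ b ∷ ys ⊆ xs ++ b ∷ a ∷ ys
  ++-swap-⊆ xs {a} {b} ys = ∈-resp-↭ (++⁺ˡ xs (↭-swap a b ↭-refl))

-- Distinct names, so that each hypothesis of a quoted box is referred to by exactly one variable.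
ctxFrom : ∀ {l} → Var → List (Ty l) → Ctx l
ctxFrom x []       = []
ctxFrom x (T ∷ Ts) = (x , T) ∷ ctxFrom (suc x) Ts

rg-ctxFrom : ∀ {l} x (Ts : List (Ty l)) → rg (ctxFrom x Ts) ≡ Ts
rg-ctxFrom x []       = refl
rg-ctxFrom x (T ∷ Ts) = cong (T ∷_) (rg-ctxFrom (suc x) Ts)

nameAt : ∀ {l} {T : Ty l} {Ts} → Var → T ∈ Ts → Var
nameAt x (here _)  = x
nameAt x (there p) = nameAt (suc x) p

∈-ctxFrom : ∀ {l} {T : Ty l} {Ts} x (p : T ∈ Ts) → (nameAt x p , T) ∈ ctxFrom x Ts
∈-ctxFrom x (here refl) = here refl
∈-ctxFrom x (there p)   = there (∈-ctxFrom (suc x) p)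

quoOver : ∀ {l} → List (Ty l) → Tm → Tm
quoOver Ts M = quo (dom (ctxFrom 0 Ts)) M

tquoOver : ∀ {l} {Δ : Stack (suc l)} {Ts : List (Ty l)} {M B}
         → (Δ ▸ ctxFrom 0 Ts) ⊢ M ∶ B → Δ ⊢ quoOver Ts M ∶ ([ Ts ] B)
tquoOver {Δ = Δ} {Ts} {M} {B} ⊢M =
  subst (λ Us → Δ ⊢ quoOver Ts M ∶ ([ Us ] B)) (rg-ctxFrom 0 Ts) (tquo ⊢M)

varsAlong : ∀ {l} (Ts : List (Ty l)) {Us} → Ts ⊆ Us → List Tm
varsAlong []       ρ = []
varsAlong (T ∷ Ts) ρ = var (nameAt 0 (ρ (here refl))) ∷ varsAlong Ts (λ p → ρ (there p))

tvarsAlong : ∀ {l} {Δ : Stack (suc l)} (Ts : List (Ty l)) {Us} (ρ : Ts ⊆ Us)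
           → (Δ ▸ ctxFrom 0 Us) ⊢* varsAlong Ts ρ ∶ Ts
tvarsAlong []       ρ = []
tvarsAlong (T ∷ Ts) ρ = tvar (∈-ctxFrom 0 (ρ (here refl))) ∷ tvarsAlong Ts (λ p → ρ (there p))

_⊢*-,,_ : ∀ {l} {Δ : Stack l} {Ns As N A} → Δ ⊢* Ns ∶ As → Δ ⊢ N ∶ A → Δ ⊢* (Ns ,, N) ∶ (As ,, A)
[]         ⊢*-,, ⊢N = ⊢N ∷ []
(⊢M ∷ ⊢Ms) ⊢*-,, ⊢N = ⊢M ∷ (⊢Ms ⊢*-,, ⊢N)

rename-box : ∀ {l} (Ts Us : List (Ty l)) → Ts ⊆ Us → Tm → Tm
rename-box Ts Us ρ M = quoOver Us (unq (varsAlong Ts ρ) M)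

trename-box : ∀ {l} {Δ : Stack (suc l)} {Ts Us : List (Ty l)} {M A} (ρ : Ts ⊆ Us)
            → Δ ⊢ M ∶ ([ Ts ] A) → Δ ⊢ rename-box Ts Us ρ M ∶ ([ Us ] A)
trename-box {Ts = Ts} ρ ⊢M = tquoOver (tunq ⊢M (tvarsAlong Ts ρ))

cut-box : ∀ {l} (Ts : List (Ty l)) → Tm → Tm → Tm
cut-box Ts M N = quoOver Ts (unq (ids ,, unq ids M) N)
  where ids = varsAlong Ts (λ p → p)

tcut-box : ∀ {l} {Δ : Stack (suc l)} {Ts : List (Ty l)} {M N A B}
         → Δ ⊢ M ∶ ([ Ts ] B) → Δ ⊢ N ∶ ([ Ts ,, B ] A) → Δ ⊢ cut-box Ts M N ∶ ([ Ts ] A)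
tcut-box {Ts = Ts} ⊢M ⊢N = tquoOver (tunq ⊢N (⊢ids ⊢*-,, tunq ⊢M ⊢ids))
  where ⊢ids = tvarsAlong Ts (λ p → p)

closed-rename : ∀ {l} (Ts Us : List (Ty l)) (A : Ty l) → Ts ⊆ Us → Closed (([ Ts ] A) ⇒ ([ Us ] A))
closed-rename Ts Us A ρ = lam 0 (rename-box Ts Us ρ (var 0)) , tabs (trename-box ρ (tvar (here refl)))

closed-cut : ∀ {l} (Ts : List (Ty l)) (A B : Ty l) → Closed (([ Ts ] B) ⇒ ([ Ts ,, B ] A) ⇒ ([ Ts ] A))
closed-cut Ts A B =
  lam 0 (lam 1 (cut-box Ts (var 0) (var 1))) ,
  tabs (tabs (tcut-box (tvar (here refl)) (tvar (there (here refl)))))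

theorem6p1 : (l : ℕ) (Γ Γ' : List (Ty l)) (A B B' : Ty l)
    → Closed (([ Γ ] A) ⇒ ([ Γ ,, B ] A))
    × Closed (([ Γ ,, B ,, B ] A) ⇒ ([ Γ ,, B ] A))
    × Closed (([ Γ ++ (B ∷ B' ∷ Γ') ] A) ⇒ ([ Γ ++ (B' ∷ B ∷ Γ') ] A))
    × Closed (([ Γ ] B) ⇒ ([ Γ ,, B ] A) ⇒ ([ Γ ] A))
theorem6p1 l Γ Γ' A B B' =
  closed-rename Γ (Γ ,, B) A ∈-,,⁺ˡ ,
  closed-rename (Γ ,, B ,, B) (Γ ,, B) A (,,-contract-⊆ Γ) ,
  closed-rename (Γ ++ B ∷ B' ∷ Γ') (Γ ++ B' ∷ B ∷ Γ') A (++-swap-⊆ Γ Γ') ,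
  closed-cut Γ A B
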